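{- Let $G$ be an interval graph and $T$ a PQ tree of $G$. Let $X$ be a node of $T$ with children $X_1,\ldots,X_k$ (in their current left-to-right order), let $u,v\in X$, and let $T_X$ be the subtree of $T$ rooted at $X$. Then: (i) if $v$ belongs to every leaf of $T_X$, then $T_X$ is compatible with $u<v$; (ii) if $X_i,X_j\in\{X_1,\ldots,X_k\}$ are such that $u\in X_i$, $v\notin X_i$, $v\in X_j$, and $T_X$ is compatible with $u<v$, then $X_i$ precedes $X_j$ among the children of $X$.
   Context: A PQ tree of an interval graph $G$ is an ordered rooted tree whose leaves are the maximal cliques of $G$ and whose internal nodes are of type P or Q; equivalent trees are obtained by permuting children of P nodes or reversing children of Q nodes, and the left-to-right leaf sequences of the trees equivalent to $T$ are exactly the canonical clique orderings of $G$ (orderings $C_1,\ldots,C_t$ of the maximal cliques such that each vertex lies in a set of consecutive cliques). A vertex $v$ belongs to a node $X$ (written $v\in X$) if $v$ belongs to some leaf descending from $X$. For a (sub)tree $T'$ with left-to-right leaf sequence $s_{T'}=C_1,\ldots,C_t$, let $G'$ be the subgraph induced by the union of its leaves; $T'$ is compatible with the restriction $u<v$ if there is a canonical ordering $s$ of $G'$ (an ordering such that for all $p$ before $q$ before $r$, $(p,r)\in E$ implies $(q,r)\in E$) that is ordered according to $s_{T'}$ (i.e., for all $a$ before $b$ in $s$ there are no $i<j$ with $b\in C_i\setminus C_j$ and $a\in C_j$) and in which $u$ precedes $v$. -}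

module Defs where

open import Data.Nat using (ℕ; _≤_)
open import Data.Fin using (Fin) renaming (_<_ to _<ᶠ_)
open import Data.Fin.Subset using (Subset; _⊆_) renaming (_∈_ to _∈ₛ_; _∉_ to _∉ₛ_)
open import Data.List using (List; []; _∷_; _++_; length; lookup; reverse)
open import Data.List.Relation.Unary.Any using (Any)
open import Data.List.Relation.Unary.All using (All)
open import Data.List.Relation.Unary.Unique.Propositional using (Unique)
open import Data.List.Relation.Binary.Pointwise using (Pointwise)
open import Data.List.Relation.Binary.Permutation.Propositional using (_↭_)
import Data.List.Membership.Propositional as LM
open import Data.Product using (Σ; ∃; ∃-syntax; _×_)
open import Relation.Binary.PropositionalEquality using (_≡_; _≢_)
open import Relation.Nullary using (¬_)
open import Function.Bundles using (_⇔_)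

record Graph (n : ℕ) : Set₁ where
  field
    Adj    : Fin n → Fin n → Set
    sym    : ∀ {u v} → Adj u v → Adj v u
    irrefl : ∀ {u} → ¬ Adj u u
open Graph public

-- Interval graph: intersection graph of closed intervals [l v , r v]
-- (integer endpoints suffice for finite interval graphs).
IntervalGraph : ∀ {n} → Graph n → Set
IntervalGraph {n} G =
  Σ (Fin n → ℕ) λ l → Σ (Fin n → ℕ) λ r →
    (∀ v → l v ≤ r v) ×
    (∀ u v → Adj G u v ⇔ (u ≢ v × l u ≤ r v × l v ≤ r u))

IsClique : ∀ {n} → Graph n → Subset n → Set
IsClique G C = ∀ u v → u ∈ₛ C → v ∈ₛ C → u ≢ v → Adj G u v

IsMaximalClique : ∀ {n} → Graph n → Subset n → Set
IsMaximalClique G C =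
  IsClique G C × (∀ C' → IsClique G C' → C ⊆ C' → C' ≡ C)

IsCanonicalCliqueOrdering : ∀ {n} → Graph n → List (Subset n) → Set
IsCanonicalCliqueOrdering {n} G cs =
  Unique cs ×
  (∀ C → C LM.∈ cs ⇔ IsMaximalClique G C) ×
  (∀ (v : Fin n) (i j k : Fin (length cs)) → i <ᶠ j → j <ᶠ k →
     v ∈ₛ lookup cs i → v ∈ₛ lookup cs k → v ∈ₛ lookup cs j)

data PQ (A : Set) : Set where
  leaf : A → PQ A
  P    : List (PQ A) → PQ A
  Q    : List (PQ A) → PQ A

module _ {A : Set} where

  mutual
    frontier : PQ A → List A
    frontier (leaf a) = a ∷ []
    frontier (P xs)   = frontiers xs
    frontier (Q xs)   = frontiers xs

    frontiers : List (PQ A) → List A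
    frontiers []       = []
    frontiers (x ∷ xs) = frontier x ++ frontiers xs

  children : PQ A → List (PQ A)
  children (leaf _) = []
  children (P xs)   = xs
  children (Q xs)   = xs

  data _≈T_ : PQ A → PQ A → Set where
    leaf : ∀ {a} → leaf a ≈T leaf a
    P    : ∀ {xs ys zs} → Pointwise _≈T_ xs ys → ys ↭ zs → P xs ≈T P zs
    Q    : ∀ {xs ys} → Pointwise _≈T_ xs ys → Q xs ≈T Q ys
    Qrev : ∀ {xs ys} → Pointwise _≈T_ xs ys → Q xs ≈T Q (reverse ys)

  -- X is a node of T (X is the subtree of T rooted at that node)
  data _⊑_ (X : PQ A) : PQ A → Set where
    here : X ⊑ X
    inP  : ∀ {xs} → Any (X ⊑_) xs → X ⊑ P xs
    inQ  : ∀ {xs} → Any (X ⊑_) xs → X ⊑ Q xs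

IsPQTreeOf : ∀ {n} → Graph n → PQ (Subset n) → Set
IsPQTreeOf G T =
  ∀ cs → (∃[ T' ] (T ≈T T' × frontier T' ≡ cs)) ⇔ IsCanonicalCliqueOrdering G cs

_∈N_ : ∀ {n} → Fin n → PQ (Subset n) → Set
v ∈N X = Any (v ∈ₛ_) (frontier X)

Before : ∀ {n} → List (Fin n) → Fin n → Fin n → Set
Before s a b = ∃[ i ] ∃[ j ] (i <ᶠ j × lookup s i ≡ a × lookup s j ≡ b)

IsCanonicalVertexOrdering : ∀ {n} → Graph n → PQ (Subset n) → List (Fin n) → Set
IsCanonicalVertexOrdering {n} G T' s =
  Unique s ×
  (∀ w → w LM.∈ s ⇔ w ∈N T') ×
  (∀ (i j k : Fin (length s)) → i <ᶠ j → j <ᶠ k →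
     Adj G (lookup s i) (lookup s k) → Adj G (lookup s j) (lookup s k))

OrderedAccordingTo : ∀ {n} → List (Fin n) → List (Subset n) → Set
OrderedAccordingTo s cs =
  ∀ a b → Before s a b →
    ¬ (∃[ i ] ∃[ j ] (i <ᶠ j × b ∈ₛ lookup cs i × b ∉ₛ lookup cs j × a ∈ₛ lookup cs j))

CompatibleWith : ∀ {n} → Graph n → PQ (Subset n) → Fin n → Fin n → Set
CompatibleWith G T' u v =
  ∃[ s ] (IsCanonicalVertexOrdering G T' s ×
          OrderedAccordingTo s (frontier T') ×
          Before s u v)

module Submission where

-- Write m = C₁ … C_t for the leaf sequence of the subtree T_X.  Everything the
-- proof needs about m is collected in the notion of a *clique sequence*: every
-- Cᵢ is a clique, the cliques containing any fixed vertex are consecutive, and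
-- two adjacent vertices occurring in m occur together in some Cᵢ.  The leaf
-- sequence of T itself is a canonical clique ordering, hence a clique sequence
-- (edges lie in maximal cliques, built greedily since adjacency in an interval
-- graph is decidable), and the property passes to the infix m.
--
-- (i) If v lies in every Cᵢ, list the other vertices of T_X sorted by the index
--     of the LAST clique containing them, and put v at the end.  Consecutiveness
--     and the covering of edges give the umbrella property and the order
--     condition; u comes before v by construction.
-- (ii) Needs no graph theory: if X_j came before X_i, some C_a in X_j contains v
--     and some later C_b in X_i contains u but not v, which an ordering that is
--     ordered according to m and puts u before v forbids.

open import Defs
open import Data.Nat using (ℕ)
open import Data.Fin using (Fin; _<_)
open import Data.Fin.Subset using (Subset) renaming (_∈_ to _∈ₛ_)
open import Data.List using (length; lookup)
open import Data.List.Relation.Unary.All using (All)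
open import Data.Product using (_×_)
open import Relation.Nullary using (¬_)
open import Relation.Binary.PropositionalEquality using (_≢_)

import Data.Nat as ℕ
open import Data.Nat using (zero; suc; _+_; _∸_; _≤_; z≤n; s≤s; pred)
open import Data.Nat.Properties
  using ( ≤-refl; ≤-trans; <⇒≤; ≤-<-trans; <-≤-trans; m≤m+n; +-monoʳ-≤; +-monoʳ-<
        ; _≤?_; _<?_; ≤-total; ≰⇒>; ≮⇒≥; m+[n∸m]≡n; <⇒≤pred; m≤n⇒m<n∨m≡n; <-cmp
        ; ≤-decTotalOrder; module ≤-Reasoning)
open import Data.Fin using (zero; suc; toℕ; fromℕ<) renaming (_≟_ to _≟ᶠ_)
open import Data.Fin.Properties using (toℕ-fromℕ<; toℕ-injective; all?; ¬∀⟶∃¬)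
open import Data.Fin.Subset using (_∪_; ⁅_⁆; _⊆_)
open import Data.Fin.Subset.Properties using (_∈?_; x∈p∪q⁻; x∈p∪q⁺; x∈⁅x⁆; x∈⁅y⁆⇒x≡y; ⊆-antisym)
open import Data.List using (List; []; _∷_; _++_; filter; allFin)
open import Data.List.Properties using (++-assoc; ++-identityʳ)
open import Data.List.Relation.Unary.Any using (Any; here; there; any?)
import Data.List.Relation.Unary.Any as Any
open import Data.List.Relation.Unary.Any.Properties using (lookup-index)
open import Data.List.Relation.Unary.All using ([]; _∷_)
import Data.List.Relation.Unary.All as All
import Data.List.Relation.Unary.All.Properties as Allₚ
open import Data.List.Relation.Unary.AllPairs using (AllPairs; []; _∷_)
import Data.List.Relation.Unary.AllPairs as AllPairs
import Data.List.Relation.Unary.AllPairs.Properties as AllPairsₚ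
open import Data.List.Relation.Unary.Unique.Propositional using (Unique)
import Data.List.Relation.Unary.Unique.Propositional.Properties as Unique
open import Data.List.Membership.Propositional using (_∈_; find; lose)
open import Data.List.Membership.Propositional.Properties
  using (∈-lookup; ∈-++⁺ˡ; ∈-++⁺ʳ; ∈-++⁻; ∈-filter⁺; ∈-filter⁻; ∈-allFin)
open import Data.List.Relation.Binary.Pointwise using (Pointwise; []; _∷_)
open import Data.List.Relation.Binary.Permutation.Propositional using (_↭_; ↭-sym; ↭⇒↭ₛ)
open import Data.List.Relation.Binary.Permutation.Propositional.Properties using (∈-resp-↭)
import Data.List.Relation.Binary.Permutation.Setoid.Properties as PermutationProperties
open import Data.List.Relation.Unary.Sorted.TotalOrder.Properties using (Sorted⇒AllPairs)
open import Data.Product using (∃; ∃₂; _,_; proj₁; proj₂)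
open import Data.Sum using (_⊎_; inj₁; inj₂)
open import Data.Empty using (⊥-elim)
open import Function.Bundles using (_⇔_; mk⇔; Equivalence)
open import Relation.Binary.Bundles using (DecTotalOrder)
import Relation.Binary.Construct.On as On
open import Relation.Binary.PropositionalEquality
  using (_≡_; refl; trans; cong; subst; setoid; module ≡-Reasoning) renaming (sym to ≡-sym)
open import Relation.Nullary using (Dec; yes; no; contradiction)
open import Relation.Binary.Definitions using (tri<; tri≈; tri>)
open import Relation.Nullary.Decidable using (_×-dec_; _→-dec_; ¬?; map′)
open import Relation.Unary using (Decidable)

open Equivalence using (to; from)

data At {A : Set} (P : A → Set) : List A → ℕ → Set where
  here  : ∀ {x xs} → P x → At P (x ∷ xs) 0
  there : ∀ {x xs k} → At P xs k → At P (x ∷ xs) (suc k)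

module _ {A : Set} {P : A → Set} where

  At-< : ∀ {xs k} → At P xs k → k ℕ.< length xs
  At-< (here _)  = s≤s z≤n
  At-< (there a) = s≤s (At-< a)

  At⇒Any : ∀ {xs k} → At P xs k → Any P xs
  At⇒Any (here p)  = here p
  At⇒Any (there a) = there (At⇒Any a)

  Any⇒At : ∀ {xs} → Any P xs → ∃ (At P xs)
  Any⇒At (here p) = 0 , here p
  Any⇒At (there a) with Any⇒At a
  ... | k , at = suc k , there at

  All⇒At : ∀ {xs k} → All P xs → k ℕ.< length xs → At P xs k
  All⇒At {k = zero}  (p ∷ _)  _         = here p
  All⇒At {k = suc k} (_ ∷ ps) (s≤s k<) = there (All⇒At ps k<)

  At⇒lookup : ∀ {xs k} → At P xs k → ∃ λ (i : Fin (length xs)) → toℕ i ≡ k × P (lookup xs i)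
  At⇒lookup (here p) = zero , refl , p
  At⇒lookup (there a) with At⇒lookup a
  ... | i , refl , p = suc i , refl , p

  lookup⇒At : ∀ {xs} (i : Fin (length xs)) → P (lookup xs i) → At P xs (toℕ i)
  lookup⇒At {_ ∷ _} zero    p = here p
  lookup⇒At {_ ∷ _} (suc i) p = there (lookup⇒At i p)

  At-lookup : ∀ {xs} (i : Fin (length xs)) → At P xs (toℕ i) → P (lookup xs i)
  At-lookup {_ ∷ _} zero    (here p)  = p
  At-lookup {_ ∷ _} (suc i) (there a) = At-lookup i a

  At-++ˡ : ∀ {xs ys k} → At P xs k → At P (xs ++ ys) k
  At-++ˡ (here p)  = here p
  At-++ˡ (there a) = there (At-++ˡ a)

  At-++ʳ : ∀ xs {ys k} → At P ys k → At P (xs ++ ys) (length xs + k)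
  At-++ʳ []       a = a
  At-++ʳ (_ ∷ xs) a = there (At-++ʳ xs a)

  At-++ˡ⁻ : ∀ xs {ys k} → At P (xs ++ ys) k → k ℕ.< length xs → At P xs k
  At-++ˡ⁻ (_ ∷ _)  (here p)  _         = here p
  At-++ˡ⁻ (_ ∷ xs) (there a) (s≤s k<) = there (At-++ˡ⁻ xs a k<)

  At-++ʳ⁻ : ∀ xs {ys k} → At P (xs ++ ys) (length xs + k) → At P ys k
  At-++ʳ⁻ []       a         = a
  At-++ʳ⁻ (_ ∷ xs) (there a) = At-++ʳ⁻ xs a

  At-infix⁺ : ∀ pre {m post k} → At P m k → At P (pre ++ m ++ post) (length pre + k)
  At-infix⁺ pre a = At-++ʳ pre (At-++ˡ a)

  At-infix⁻ : ∀ pre {m post k} → At P (pre ++ m ++ post) (length pre + k) →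
              k ℕ.< length m → At P m k
  At-infix⁻ pre {m} a k< = At-++ˡ⁻ m (At-++ʳ⁻ pre a) k<

At-zip : ∀ {A : Set} {P Q : A → Set} {xs k} → At P xs k → At Q xs k →
         At (λ x → P x × Q x) xs k
At-zip (here p)  (here q)  = here (p , q)
At-zip (there a) (there b) = there (At-zip a b)

At-map : ∀ {A : Set} {P Q : A → Set} {xs k} → (∀ {x} → P x → Q x) → At P xs k → At Q xs k
At-map f (here p)  = here (f p)
At-map f (there a) = there (At-map f a)

Before-++ : ∀ {n} {a b : Fin n} xs ys → a ∈ xs → b ∈ ys → Before (xs ++ ys) a b
Before-++ (_ ∷ xs) ys (here refl) b∈ =
  zero , suc (Any.index (∈-++⁺ʳ xs b∈)) , s≤s z≤n , refl , ≡-sym (lookup-index (∈-++⁺ʳ xs b∈))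
Before-++ (_ ∷ xs) ys (there a∈) b∈ with Before-++ xs ys a∈ b∈
... | i , j , i<j , a≡ , b≡ = suc i , suc j , s≤s i<j , a≡ , b≡

AllPairs-lookup : ∀ {A : Set} {R : A → A → Set} {xs : List A} → AllPairs R xs →
  ∀ {i j : Fin (length xs)} → i < j → R (lookup xs i) (lookup xs j)
AllPairs-lookup (r ∷ _)  {zero}  {suc j} _         = All.lookup r (∈-lookup j)
AllPairs-lookup (_ ∷ rs) {suc i} {suc j} (s≤s i<j) = AllPairs-lookup rs i<j

AllPairs-Before : ∀ {n} {R : Fin n → Fin n → Set} {s : List (Fin n)} → AllPairs R s →
  ∀ {a b} → Before s a b → R a b
AllPairs-Before rs (i , j , i<j , refl , refl) = AllPairs-lookup rs i<j

AllPairs-withLeft : ∀ {A : Set} {P : A → Set} {R : A → A → Set} {xs : List A} →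
  All P xs → AllPairs R xs → AllPairs (λ x y → P x × R x y) xs
AllPairs-withLeft []       []       = []
AllPairs-withLeft (p ∷ ps) (r ∷ rs) = All.map (p ,_) r ∷ AllPairs-withLeft ps rs

Convex : ∀ {A : Set} → (A → Set) → List A → Set
Convex φ xs = ∀ {i j k} → i ≤ j → j ≤ k → At φ xs i → At φ xs k → At φ xs j

Between : ℕ → ℕ → ℕ → Set
Between i j k = (i ≤ j × j ≤ k) ⊎ (k ≤ j × j ≤ i)

module _ {A : Set} {P : A → Set} where

  convex-between : ∀ {xs i j k} → Convex P xs → Between i j k →
                   At P xs i → At P xs k → At P xs j
  convex-between c (inj₁ (i≤j , j≤k)) ai ak = c i≤j j≤k ai ak
  convex-between c (inj₂ (k≤j , j≤i)) ai ak = c k≤j j≤i ak ai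

  convex-fromLookup : ∀ {xs} →
    (∀ (i j k : Fin (length xs)) → i < j → j < k →
       P (lookup xs i) → P (lookup xs k) → P (lookup xs j)) → Convex P xs
  convex-fromLookup {xs} h {i} {j} i≤j j≤k ai ak
    with m≤n⇒m<n∨m≡n i≤j | m≤n⇒m<n∨m≡n j≤k
  ... | inj₂ refl | _         = ai
  ... | inj₁ _    | inj₂ refl = ak
  ... | inj₁ i<j  | inj₁ j<k with At⇒lookup ai | At⇒lookup ak
  ... | fi , refl , pi | fk , refl , pk =
    subst (At P xs) (toℕ-fromℕ< j<len) (lookup⇒At fj (h fi fj fk fi<fj fj<fk pi pk))
    where
    j<len : j ℕ.< length xs
    j<len = <-≤-trans j<k (<⇒≤ (At-< ak))
    fj : Fin (length xs)
    fj = fromℕ< j<len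
    fi<fj : fi < fj
    fi<fj = subst (toℕ fi ℕ.<_) (≡-sym (toℕ-fromℕ< j<len)) i<j
    fj<fk : fj < fk
    fj<fk = subst (ℕ._< toℕ fk) (≡-sym (toℕ-fromℕ< j<len)) j<k

  convex-infix : ∀ pre {m} post → Convex P (pre ++ m ++ post) → Convex P m
  convex-infix pre post c i≤j j≤k ai ak =
    At-infix⁻ pre
      (c (+-monoʳ-≤ (length pre) i≤j) (+-monoʳ-≤ (length pre) j≤k)
         (At-infix⁺ pre {post = post} ai) (At-infix⁺ pre ak))
      (≤-<-trans j≤k (At-< ak))

-- Any position g can be moved into a nonempty window [a, a + t) without
-- crossing a point of the window: the result lies between g and a + x for
-- every x < t.  This lets a convex property leave the surrounding list.
clamp : ∀ a t g → 0 ℕ.< t →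
  ∃ λ c → c ℕ.< t × (∀ x → x ℕ.< t → Between g (a + c) (a + x))
clamp a t g 0<t with g ≤? a
... | yes g≤a = 0 , 0<t , λ x _ → inj₁ (≤-trans g≤a (m≤m+n a 0) , +-monoʳ-≤ a z≤n)
... | no g≰a with g ∸ a <? t
...   | yes d<t = g ∸ a , d<t , λ x _ → subst (λ y → Between g y (a + x)) (≡-sym a+d≡g) (between-refl (a + x))
  where
  a+d≡g : a + (g ∸ a) ≡ g
  a+d≡g = m+[n∸m]≡n (<⇒≤ (≰⇒> g≰a))
  between-refl : ∀ y → Between g g y
  between-refl y with ≤-total g y
  ... | inj₁ g≤y = inj₁ (≤-refl , g≤y)
  ... | inj₂ y≤g = inj₂ (y≤g , ≤-refl)
...   | no d≮t = pred t , pred-< 0<t , λ x x<t → inj₂ (+-monoʳ-≤ a (<⇒≤pred x<t) , last≤g)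
  where
  pred-< : ∀ {t} → 0 ℕ.< t → pred t ℕ.< t
  pred-< (s≤s _) = ≤-refl
  last≤g : a + pred t ≤ g
  last≤g = begin
    a + pred t     ≤⟨ +-monoʳ-≤ a (<⇒≤ (<-≤-trans (pred-< 0<t) (≮⇒≥ d≮t))) ⟩
    a + (g ∸ a)    ≡⟨ m+[n∸m]≡n (<⇒≤ (≰⇒> g≰a)) ⟩
    g              ∎
    where open ≤-Reasoning

module _ {A : Set} {P : A → Set} (P? : Decidable P) where

  -- 0 if there is no such position.
  lastIndex : List A → ℕ
  lastIndex []       = 0
  lastIndex (_ ∷ xs) with any? P? xs
  ... | yes _ = suc (lastIndex xs)
  ... | no _  = 0

  lastIndex-max : ∀ {xs j} → At P xs j → j ≤ lastIndex xs
  lastIndex-max         (here _)  = z≤n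
  lastIndex-max {_ ∷ xs} (there a) with any? P? xs
  ... | yes _    = s≤s (lastIndex-max a)
  ... | no noneP = contradiction (At⇒Any a) noneP

  lastIndex-at : ∀ {xs} → Any P xs → At P xs (lastIndex xs)
  lastIndex-at {x ∷ xs} p with any? P? xs | p
  ... | yes later | _         = there (lastIndex-at later)
  ... | no _      | here px   = here px
  ... | no noneP  | there pxs = contradiction pxs noneP

module _ {n : ℕ} (G : Graph n) where

  Consecutive : List (Subset n) → Set
  Consecutive cs = ∀ (w : Fin n) → Convex (w ∈ₛ_) cs

  EdgesCovered : List (Subset n) → Set
  EdgesCovered cs = ∀ {p r} → Adj G p r → Any (p ∈ₛ_) cs → Any (r ∈ₛ_) cs →
                    ∃ λ k → At (p ∈ₛ_) cs k × At (r ∈ₛ_) cs k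

  record CliqueSequence (cs : List (Subset n)) : Set where
    field
      cliques     : All (IsClique G) cs
      consecutive : Consecutive cs
      covered     : EdgesCovered cs

  together⇒Adj : ∀ {cs p q k} → All (IsClique G) cs →
    At (p ∈ₛ_) cs k → At (q ∈ₛ_) cs k → p ≢ q → Adj G p q
  together⇒Adj cl ap aq p≢q with find (At⇒Any (At-zip ap aq))
  ... | c , c∈ , p∈c , q∈c = All.lookup cl c∈ _ _ p∈c q∈c p≢q

  CliqueSequence-infix : ∀ pre m post → CliqueSequence (pre ++ m ++ post) → CliqueSequence m
  CliqueSequence-infix pre m post seq = record
    { cliques     = Allₚ.++⁻ˡ m (Allₚ.++⁻ʳ pre cliques)
    ; consecutive = λ w → convex-infix pre post (consecutive w)
    ; covered     = covered-infix
    }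
    where
    open CliqueSequence seq
    a = length pre

    -- Move a common position g of p and r in the whole list into the window of m.
    covered-infix : EdgesCovered m
    covered-infix {p} {r} pr p∈m r∈m with Any⇒At p∈m | Any⇒At r∈m
    ... | x , px | y , ry
      with covered pr (At⇒Any (At-infix⁺ pre {post = post} px)) (At⇒Any (At-infix⁺ pre {post = post} ry))
    ... | g , pg , rg with clamp a (length m) g (≤-<-trans z≤n (At-< px))
    ... | c , c<t , between = c , move px pg , move ry rg
      where
      move : ∀ {w z} → At (w ∈ₛ_) m z → At (w ∈ₛ_) (pre ++ m ++ post) g → At (w ∈ₛ_) m c
      move {w} {z} wz wg =
        At-infix⁻ pre
          (convex-between (consecutive w) (between z (At-< wz)) wg (At-infix⁺ pre wz)) c<t

module MaximalCliques {n : ℕ} (G : Graph n) (adj? : ∀ u v → Dec (Adj G u v)) where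

  Joinable : Fin n → Subset n → Set
  Joinable w D = ∀ x → x ∈ₛ D → x ≢ w → Adj G w x

  joinable? : ∀ w D → Dec (Joinable w D)
  joinable? w D = all? λ x → (x ∈? D) →-dec (¬? (x ≟ᶠ w) →-dec adj? w x)

  add : Fin n → Subset n → Subset n
  add w D with joinable? w D
  ... | yes _ = D ∪ ⁅ w ⁆
  ... | no _  = D

  grow : Subset n → List (Fin n) → Subset n
  grow D []       = D
  grow D (w ∷ ws) = grow (add w D) ws

  add-⊇ : ∀ w D → D ⊆ add w D
  add-⊇ w D x∈ with joinable? w D
  ... | yes _ = x∈p∪q⁺ (inj₁ x∈)
  ... | no _  = x∈

  grow-⊇ : ∀ D ws → D ⊆ grow D ws
  grow-⊇ D []       x∈ = x∈
  grow-⊇ D (w ∷ ws) x∈ = grow-⊇ (add w D) ws (add-⊇ w D x∈)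

  add-clique : ∀ w D → IsClique G D → IsClique G (add w D)
  add-clique w D cl x y x∈ y∈ x≢y with joinable? w D
  ... | no _ = cl x y x∈ y∈ x≢y
  ... | yes ok with x∈p∪q⁻ D _ x∈ | x∈p∪q⁻ D _ y∈
  ...   | inj₁ x∈D | inj₁ y∈D = cl x y x∈D y∈D x≢y
  ...   | inj₂ x≡w | inj₁ y∈D rewrite x∈⁅y⁆⇒x≡y w x≡w = ok y y∈D (λ y≡w → x≢y (≡-sym y≡w))
  ...   | inj₁ x∈D | inj₂ y≡w rewrite x∈⁅y⁆⇒x≡y w y≡w = Graph.sym G (ok x x∈D x≢y)
  ...   | inj₂ x≡w | inj₂ y≡w = contradiction (trans (x∈⁅y⁆⇒x≡y w x≡w) (≡-sym (x∈⁅y⁆⇒x≡y w y≡w))) x≢y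

  grow-clique : ∀ D ws → IsClique G D → IsClique G (grow D ws)
  grow-clique D []       cl = cl
  grow-clique D (w ∷ ws) cl = grow-clique (add w D) ws (add-clique w D cl)

  Blocked : Fin n → Subset n → Set
  Blocked w C = ∃ λ x → x ∈ₛ C × x ≢ w × ¬ Adj G w x

  grow-offered : ∀ D ws {w} → w ∈ ws → w ∈ₛ grow D ws ⊎ Blocked w (grow D ws)
  grow-offered D (y ∷ ws) (there w∈) = grow-offered (add y D) ws w∈
  grow-offered D (w ∷ ws) (here refl) with joinable? w D
  ... | yes _ = inj₁ (grow-⊇ _ ws (x∈p∪q⁺ (inj₂ (x∈⁅x⁆ w))))
  ... | no ¬ok with ¬∀⟶∃¬ n _ (λ x → (x ∈? D) →-dec (¬? (x ≟ᶠ w) →-dec adj? w x)) ¬ok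
  ...   | x , ¬ok-x with x ∈? D | x ≟ᶠ w | adj? w x
  ...     | no x∉D | _       | _      = contradiction (λ x∈D → contradiction x∈D x∉D) ¬ok-x
  ...     | yes _  | yes x≡w | _      = contradiction (λ _ x≢w → contradiction x≡w x≢w) ¬ok-x
  ...     | yes _  | no _    | yes wx = contradiction (λ _ _ → wx) ¬ok-x
  ...     | yes x∈D | no x≢w | no ¬wx = inj₂ (x , grow-⊇ D ws x∈D , x≢w , ¬wx)

  grow-maximal : ∀ D → IsClique G D → IsMaximalClique G (grow D (allFin n))
  grow-maximal D cl = grow-clique D (allFin n) cl , λ C' cl' C⊆C' →
    ⊆-antisym (λ {x} x∈C' → included cl' C⊆C' x∈C') C⊆C'
    where
    C = grow D (allFin n)
    included : ∀ {C' x} → IsClique G C' → C ⊆ C' → x ∈ₛ C' → x ∈ₛ C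
    included {x = x} cl' C⊆C' x∈C' with grow-offered D (allFin n) (∈-allFin x)
    ... | inj₁ x∈C = x∈C
    ... | inj₂ (y , y∈C , y≢x , ¬xy) =
      contradiction (cl' x y x∈C' (C⊆C' y∈C) (λ x≡y → y≢x (≡-sym x≡y))) ¬xy

  edge-in-maximalClique : ∀ {p r} → Adj G p r →
    ∃ λ C → IsMaximalClique G C × p ∈ₛ C × r ∈ₛ C
  edge-in-maximalClique {p} {r} pr =
    grow pair (allFin n) , grow-maximal pair pair-clique ,
    grow-⊇ pair (allFin n) (x∈p∪q⁺ (inj₁ (x∈⁅x⁆ p))) ,
    grow-⊇ pair (allFin n) (x∈p∪q⁺ (inj₂ (x∈⁅x⁆ r)))
    where
    pair = ⁅ p ⁆ ∪ ⁅ r ⁆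
    pair-clique : IsClique G pair
    pair-clique x y x∈ y∈ x≢y with x∈p∪q⁻ ⁅ p ⁆ _ x∈ | x∈p∪q⁻ ⁅ p ⁆ _ y∈
    ... | inj₁ x≡p | inj₁ y≡p = contradiction (trans (x∈⁅y⁆⇒x≡y p x≡p) (≡-sym (x∈⁅y⁆⇒x≡y p y≡p))) x≢y
    ... | inj₂ x≡r | inj₂ y≡r = contradiction (trans (x∈⁅y⁆⇒x≡y r x≡r) (≡-sym (x∈⁅y⁆⇒x≡y r y≡r))) x≢y
    ... | inj₁ x≡p | inj₂ y≡r rewrite x∈⁅y⁆⇒x≡y p x≡p | x∈⁅y⁆⇒x≡y r y≡r = pr
    ... | inj₂ x≡r | inj₁ y≡p rewrite x∈⁅y⁆⇒x≡y r x≡r | x∈⁅y⁆⇒x≡y p y≡p = Graph.sym G pr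

interval-adj? : ∀ {n} (G : Graph n) → IntervalGraph G → ∀ u v → Dec (Adj G u v)
interval-adj? G (l , r , _ , adj⇔) u v =
  map′ (from (adj⇔ u v)) (to (adj⇔ u v)) (¬? (u ≟ᶠ v) ×-dec (l u ≤? r v ×-dec l v ≤? r u))

canonical⇒CliqueSequence : ∀ {n} (G : Graph n) → (∀ u v → Dec (Adj G u v)) →
  ∀ {cs} → IsCanonicalCliqueOrdering G cs → CliqueSequence G cs
canonical⇒CliqueSequence G adj? {cs} (_ , maximal⇔ , consecutive) = record
  { cliques     = All.tabulate (λ {c} c∈ → proj₁ (to (maximal⇔ c) c∈))
  ; consecutive = λ w → convex-fromLookup (consecutive w)
  ; covered     = λ pr _ _ → common-position pr
  }
  where
  open MaximalCliques G adj?
  -- The maximal clique through an edge is one of the cliques of cs.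
  common-position : ∀ {p r} → Adj G p r → ∃ λ k → At (p ∈ₛ_) cs k × At (r ∈ₛ_) cs k
  common-position pr with edge-in-maximalClique pr
  ... | C , maxC , p∈C , r∈C with Any⇒At (lose (from (maximal⇔ C) maxC) (p∈C , r∈C))
  ... | k , both = k , At-map proj₁ both , At-map proj₂ both

module LastCliqueOrdering {n : ℕ} (G : Graph n) (X : PQ (Subset n))
  (sequence : CliqueSequence G (frontier X))
  (v : Fin n) (v∈X : v ∈N X) (v-everywhere : All (v ∈ₛ_) (frontier X)) where

  open CliqueSequence sequence

  m : List (Subset n)
  m = frontier X

  last : Fin n → ℕ
  last w = lastIndex (w ∈?_) m

  byLast : DecTotalOrder _ _ _
  byLast = On.decTotalOrder ≤-decTotalOrder last

  open import Data.List.Sort byLast using (sort; sort-↭; sort-↗)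

  Other : Fin n → Set
  Other w = w ∈N X × w ≢ v

  other? : Decidable Other
  other? w = any? (w ∈?_) m ×-dec ¬? (w ≟ᶠ v)

  candidates : List (Fin n)
  candidates = filter other? (allFin n)

  others : List (Fin n)
  others = sort candidates

  ordering : List (Fin n)
  ordering = others ++ v ∷ []

  others-⇔ : ∀ {w} → w ∈ others ⇔ Other w
  others-⇔ {w} = mk⇔
    (λ w∈ → proj₂ (∈-filter⁻ other? {xs = allFin n} (∈-resp-↭ (sort-↭ candidates) w∈)))
    (λ o → ∈-resp-↭ (↭-sym (sort-↭ candidates)) (∈-filter⁺ other? (∈-allFin w) o))

  ordering-unique : Unique ordering
  ordering-unique = Unique.++⁺ others-unique ([] ∷ [])
    λ { (w∈ , here refl) → proj₂ (to others-⇔ w∈) refl }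
    where
    others-unique : Unique others
    others-unique = PermutationProperties.Unique-resp-↭ (setoid (Fin n)) (↭⇒↭ₛ (↭-sym (sort-↭ candidates)))
                      (Unique.filter⁺ other? (Unique.allFin⁺ n))

  Precedes : Fin n → Fin n → Set
  Precedes x y = x ≢ v × (y ≡ v ⊎ last x ≤ last y)

  ordering-precedes : AllPairs Precedes ordering
  ordering-precedes = AllPairsₚ.++⁺
    (AllPairs-withLeft (All.tabulate (λ w∈ → proj₂ (to others-⇔ w∈)))
                       (AllPairs.map inj₂ (Sorted⇒AllPairs (DecTotalOrder.totalOrder byLast) (sort-↗ candidates))))
    ([] ∷ [])
    (All.tabulate λ w∈ → (proj₂ (to others-⇔ w∈) , inj₁ refl) ∷ [])

  ordering-⇔ : ∀ w → w ∈ ordering ⇔ w ∈N X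
  ordering-⇔ w = mk⇔ members complete
    where
    members : w ∈ ordering → w ∈N X
    members w∈ with ∈-++⁻ others w∈
    ... | inj₁ w∈others  = proj₁ (to others-⇔ w∈others)
    ... | inj₂ (here refl) = v∈X
    complete : w ∈N X → w ∈ ordering
    complete w∈X with w ≟ᶠ v
    ... | yes refl = ∈-++⁺ʳ others (here refl)
    ... | no w≢v   = ∈-++⁺ˡ (from others-⇔ (w∈X , w≢v))

  last-at : ∀ {w} → w ∈N X → At (w ∈ₛ_) m (last w)
  last-at = lastIndex-at (_ ∈?_)

  last-max : ∀ {w j} → At (w ∈ₛ_) m j → j ≤ last w
  last-max = lastIndex-max (_ ∈?_)

  umbrella : ∀ {p q r} → p ∈N X → q ∈N X → r ∈N X → q ≢ r →
    Precedes p q → Precedes q r → Adj G p r → Adj G q r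
  umbrella _ q∈X _ q≢r _ (_ , inj₁ refl) _ =
    together⇒Adj G cliques (last-at q∈X) (All⇒At v-everywhere (At-< (last-at q∈X))) q≢r
  umbrella _   _   _ _   (_ , inj₁ refl)  (q≢v , _)        _  = contradiction refl q≢v
  umbrella {_} {q} {r} p∈X q∈X r∈X q≢r (_ , inj₂ lp≤lq) (_ , inj₂ lq≤lr) pr
    with covered pr p∈X r∈X
  ... | k , pk , rk =
    together⇒Adj G cliques (last-at q∈X) r-at-last-q q≢r
    where
    -- r lies in the k-th and in its last leaf, and k ≤ last p ≤ last q ≤ last r.
    r-at-last-q : At (r ∈ₛ_) m (last q)
    r-at-last-q = consecutive r (≤-trans (last-max pk) lp≤lq) lq≤lr rk (last-at r∈X)

  ordering-∈N : ∀ i → lookup ordering i ∈N X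
  ordering-∈N i = to (ordering-⇔ _) (∈-lookup i)

  ordering-umbrella : ∀ (i j k : Fin (length ordering)) → i < j → j < k →
    Adj G (lookup ordering i) (lookup ordering k) → Adj G (lookup ordering j) (lookup ordering k)
  ordering-umbrella i j k i<j j<k =
    umbrella (ordering-∈N i) (ordering-∈N j) (ordering-∈N k)
      (AllPairs-lookup ordering-unique j<k)
      (AllPairs-lookup ordering-precedes i<j) (AllPairs-lookup ordering-precedes j<k)

  ordering-ordered : OrderedAccordingTo ordering m
  ordering-ordered x y x<y (i , j , i<j , y∈Ci , y∉Cj , x∈Cj)
    with AllPairs-Before ordering-precedes x<y
  ... | _ , inj₁ refl   = y∉Cj (All.lookup v-everywhere (∈-lookup j))
  ... | _ , inj₂ lx≤ly  = y∉Cj (At-lookup j y-at-j)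
    where
    y-at-i : At (y ∈ₛ_) m (toℕ i)
    y-at-i = lookup⇒At i y∈Ci
    j≤last-y : toℕ j ≤ last y
    j≤last-y = ≤-trans (last-max (lookup⇒At j x∈Cj)) lx≤ly
    y-at-j : At (y ∈ₛ_) m (toℕ j)
    y-at-j = consecutive y (<⇒≤ i<j) j≤last-y y-at-i (last-at (At⇒Any y-at-i))

  compatible : ∀ u → u ≢ v → u ∈N X → CompatibleWith G X u v
  compatible u u≢v u∈X =
    ordering , (ordering-unique , ordering-⇔ , ordering-umbrella) , ordering-ordered ,
    Before-++ others (v ∷ []) (from others-⇔ (u∈X , u≢v)) (here refl)

Any-without : ∀ {A : Set} {P R : A → Set} {ys : List A} →
  Any P ys → ¬ Any R ys → Any (λ c → P c × ¬ R c) ys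
Any-without (here p)  ¬r = here (p , λ r → ¬r (here r))
Any-without (there a) ¬r = there (Any-without a (λ r → ¬r (there r)))

module _ {n : ℕ} where

  child-At : ∀ {P : Subset n → Set} (xs : List (PQ (Subset n))) (i : Fin (length xs)) →
    Any P (frontier (lookup xs i)) → ∃ (At P (frontiers xs))
  child-At (x ∷ xs) zero a with Any⇒At a
  ... | k , at = k , At-++ˡ at
  child-At (x ∷ xs) (suc i) a with child-At xs i a
  ... | k , at = length (frontier x) + k , At-++ʳ (frontier x) at

  earlier-child : ∀ {P R : Subset n → Set} (xs : List (PQ (Subset n))) (j i : Fin (length xs)) →
    j < i → Any P (frontier (lookup xs j)) → Any R (frontier (lookup xs i)) →
    ∃₂ λ a b → a ℕ.< b × At P (frontiers xs) a × At R (frontiers xs) b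
  earlier-child (x ∷ xs) zero (suc i) _ pa ra with Any⇒At pa | child-At xs i ra
  ... | a , pat | b , rat =
    a , length (frontier x) + b , <-≤-trans (At-< pat) (m≤m+n _ b) , At-++ˡ pat , At-++ʳ (frontier x) rat
  earlier-child (x ∷ xs) (suc j) (suc i) (s≤s j<i) pa ra with earlier-child xs j i j<i pa ra
  ... | a , b , a<b , pat , rat =
    length (frontier x) + a , length (frontier x) + b , +-monoʳ-< (length (frontier x)) a<b ,
    At-++ʳ (frontier x) pat , At-++ʳ (frontier x) rat

  children-order : ∀ {s : List (Fin n)} {u v} (xs : List (PQ (Subset n))) (i j : Fin (length xs)) →
    OrderedAccordingTo s (frontiers xs) → Before s u v →
    u ∈N lookup xs i → ¬ (v ∈N lookup xs i) → v ∈N lookup xs j → i < j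
  children-order {u = u} {v} xs i j ordered u<v u∈Xi v∉Xi v∈Xj with <-cmp (toℕ i) (toℕ j)
  ... | tri< i<j _ _ = i<j
  ... | tri≈ _ i≡j _ = contradiction (subst (λ k → v ∈N lookup xs k) (≡-sym (toℕ-injective i≡j)) v∈Xj) v∉Xi
  ... | tri> _ _ j<i with earlier-child xs j i j<i v∈Xj (Any-without u∈Xi v∉Xi)
  ...   | a , b , a<b , v-at-a , u-not-v-at-b with At⇒lookup v-at-a | At⇒lookup u-not-v-at-b
  ...     | ca , refl , v∈Ca | cb , refl , (u∈Cb , v∉Cb) =
    ⊥-elim (ordered u v u<v (ca , cb , a<b , v∈Ca , v∉Cb , u∈Cb))

  -- Part (ii) for an arbitrary node: only the order condition is used.
  compatible⇒children-order : ∀ (G : Graph n) (X : PQ (Subset n)) {u v}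
    (i j : Fin (length (children X))) →
    u ∈N lookup (children X) i → ¬ (v ∈N lookup (children X) i) →
    v ∈N lookup (children X) j → CompatibleWith G X u v → i < j
  compatible⇒children-order G (leaf _) () _ _ _ _ _
  compatible⇒children-order G (P xs) i j u∈ v∉ v∈ (s , _ , ordered , u<v) =
    children-order {s = s} xs i j ordered u<v u∈ v∉ v∈
  compatible⇒children-order G (Q xs) i j u∈ v∉ v∈ (s , _ , ordered , u<v) =
    children-order {s = s} xs i j ordered u<v u∈ v∉ v∈

module _ {A : Set} where

  mutual
    ≈T-refl : (t : PQ A) → t ≈T t
    ≈T-refl (leaf a) = leaf
    ≈T-refl (P xs)   = P (≈T-refls xs) _↭_.refl
    ≈T-refl (Q xs)   = Q (≈T-refls xs)

    ≈T-refls : (xs : List (PQ A)) → Pointwise _≈T_ xs xs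
    ≈T-refls []       = []
    ≈T-refls (x ∷ xs) = ≈T-refl x ∷ ≈T-refls xs

  mutual
    subtree-infix : ∀ {X T : PQ A} → X ⊑ T →
      ∃₂ λ pre post → frontier T ≡ pre ++ frontier X ++ post
    subtree-infix here    = [] , [] , ≡-sym (++-identityʳ _)
    subtree-infix (inP a) = subtrees-infix a
    subtree-infix (inQ a) = subtrees-infix a

    subtrees-infix : ∀ {X : PQ A} {xs} → Any (X ⊑_) xs →
      ∃₂ λ pre post → frontiers xs ≡ pre ++ frontier X ++ post
    subtrees-infix {X} {x ∷ xs} (here X⊑x) with subtree-infix X⊑x
    ... | pre , post , eq = pre , post ++ frontiers xs , (begin
      frontier x ++ frontiers xs                        ≡⟨ cong (_++ frontiers xs) eq ⟩
      (pre ++ frontier X ++ post) ++ frontiers xs       ≡⟨ ++-assoc pre _ _ ⟩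
      pre ++ (frontier X ++ post) ++ frontiers xs       ≡⟨ cong (pre ++_) (++-assoc (frontier X) post _) ⟩
      pre ++ frontier X ++ post ++ frontiers xs         ∎)
      where open ≡-Reasoning
    subtrees-infix {X} {x ∷ xs} (there a) with subtrees-infix a
    ... | pre , post , eq = frontier x ++ pre , post , (begin
      frontier x ++ frontiers xs                        ≡⟨ cong (frontier x ++_) eq ⟩
      frontier x ++ pre ++ frontier X ++ post           ≡⟨ ++-assoc (frontier x) pre _ ⟨
      (frontier x ++ pre) ++ frontier X ++ post         ∎)
      where open ≡-Reasoning

subtree-CliqueSequence : ∀ {n} (G : Graph n) → IntervalGraph G →
  ∀ {T X : PQ (Subset n)} → IsPQTreeOf G T → X ⊑ T → CliqueSequence G (frontier X)
subtree-CliqueSequence G interval {T} {X} pqTree X⊑T with subtree-infix X⊑T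
... | pre , post , leaves-T = CliqueSequence-infix G pre (frontier X) post (subst (CliqueSequence G) leaves-T whole)
  where
  whole : CliqueSequence G (frontier T)
  whole = canonical⇒CliqueSequence G (interval-adj? G interval)
            (to (pqTree (frontier T)) (T , ≈T-refl T , refl))

theorem6 : ∀ {n : ℕ} (G : Graph n) → IntervalGraph G →
    (T : PQ (Subset n)) → IsPQTreeOf G T →
    (X : PQ (Subset n)) → X ⊑ T →
    (u v : Fin n) → u ≢ v → u ∈N X → v ∈N X →
    (All (v ∈ₛ_) (frontier X) → CompatibleWith G X u v) ×
    (∀ (i j : Fin (length (children X))) →
       u ∈N lookup (children X) i → ¬ (v ∈N lookup (children X) i) →
       v ∈N lookup (children X) j → CompatibleWith G X u v → i < j)
theorem6 G interval T pqTree X X⊑T u v u≢v u∈X v∈X =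
  (λ v-everywhere →
     LastCliqueOrdering.compatible G X (subtree-CliqueSequence G interval pqTree X⊑T)
       v v∈X v-everywhere u u≢v u∈X) ,
  compatible⇒children-order G X
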